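{- For every natural number $m$ (represented by the design $\textbf{m}$ on base $\vdash \sigma$), the net $\{\textbf{m}, \mathfrak{Su}_n\}$ is a non canonical term of $\mathbb{N}at$, while its normal form, i.e., the design resulting from the interaction (cut-elimination) of the cut-net $\{\textbf{m}, \mathfrak{Su}_n\}$, is $\textbf{m}\pmb{+}\textbf{n}$ (the design representing $m+n$, on base $\vdash \beta$), which is canonical.
   Context: Natural numbers are represented by designs on a positive base: $\textbf{0}_\sigma=\{(+,\sigma,\emptyset)\}$ and $(\textbf{n+1})_\sigma = (+,\sigma,\{0\})(-,\sigma.0,\{1\})\,\textbf{n}_{\sigma.0.1}$; with $\overline{0}=\epsilon$ and $\overline{n+1}=\overline{n}.0.1$, $\textbf{n}_\sigma$ is the single chronicle $(+,\sigma,\{0\})(-,\sigma.0,\{1\})\dots(+,\sigma.\overline{n},\emptyset)$. $\mathbb{N}at=\{\textbf{n}\mid n\in\mathbb{N}\}$. $Id$ denotes the partial identity (copycat) design, a subset of Girard's $\mathfrak{Fax}_{\xi\vdash\xi'}=\{(-,\xi,I)(+,\xi',I)\mathfrak{Fax}_{\xi'.i\vdash\xi.i}\mid I\in P_f(\mathbb{N})\}$ containing only the ramifications needed. The design $\mathfrak{Su}_n$, on base $\sigma\vdash\beta$, starts with a negative rule on $\sigma$ with ramifications $\emptyset$ and $\{0\}$: above $\emptyset$ it is the design $\textbf{n}$ on base $\vdash\beta$ (chronicle $(+,\beta,\{0\})(-,\beta.0,\{1\})\dots(+,\beta.\overline{n},\emptyset)$); above $\{0\}$ (sequent $\vdash\sigma.0,\beta$)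 it performs the steps $(+,\beta,\{0\})(-,\beta.0,\{1\})\dots(+,\beta.\overline{n},\{0\})(-,\beta.\overline{n}.0,\{1\})$ reaching $\vdash\sigma.0,\beta.\overline{n+1}$, then the positive action $(+,\sigma.0,\{1\})$ giving $\sigma.\overline{1}\vdash\beta.\overline{n+1}$, followed by $Id$ on $\sigma.\overline{1}\vdash\beta.\overline{n+1}$. -}

module Defs where

open import Data.Nat using (ℕ; zero; suc; _≡ᵇ_)
open import Data.Bool using (Bool; true; false; _∧_; if_then_else_)
open import Data.List using (List; []; _∷_; _++_; [_])
open import Data.List.Membership.Propositional using (_∈_)
open import Data.List.Relation.Unary.All using (All)
open import Data.List.Relation.Unary.Unique.Propositional using (Unique)
open import Data.Product using (Σ; _×_; _,_)
open import Data.Sum using (_⊎_)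
open import Data.Empty using (⊥)
open import Data.Unit using (⊤)
open import Relation.Nullary using (¬_)
open import Relation.Binary.PropositionalEquality using (_≡_)

Locus : Set
Locus = List ℕ

_∙_ : Locus → ℕ → Locus
ξ ∙ i = ξ ++ [ i ]

infixl 6 _∙_

-- A ramification is a finite set of biases, represented by a list.
Ram : Set
Ram = List ℕ

data Pol : Set where
  pos neg : Pol

flip : Pol → Pol
flip pos = neg
flip neg = pos

data Action : Set where
  act    : Pol → Locus → Ram → Action
  daimon : Action

data Positive : Action → Set where
  p-act : ∀ {ξ I} → Positive (act pos ξ I)
  p-dai : Positive daimon

data Negative : Action → Set where
  n-act : ∀ {ξ I} → Negative (act neg ξ I)

data Justifies : Action → Action → Set where
  just : ∀ {ξ I i J} → i ∈ I → Justifies (act pos ξ I) (act neg (ξ ∙ i) J)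

-- Dual of an action (the same action seen from the other side of a cut).
dual : Action → Action
dual (act p ξ I) = act (flip p) ξ I
dual daimon      = daimon

dualSeq : List Action → List Action
dualSeq []      = []
dualSeq (a ∷ s) = dual a ∷ dualSeq s

Chronicle : Set
Chronicle = List Action

IsPrefix : Chronicle → Chronicle → Set
IsPrefix c c' = Σ Chronicle λ w → c' ≡ c ++ w

-- Designs: sets of chronicles (given prefix-closed)

Design : Set₁
Design = Chronicle → Set

_≐_ : Design → Design → Set
D ≐ E = ∀ c → (D c → E c) × (E c → D c)

NoJust : Action → List Action → Set
NoJust κ t = All (λ a → ¬ Justifies a κ) t

-- View t v : v is the view of the (chronologically ordered) sequence t.
--   view(t κ⁺) = view(t) κ⁺
--   view(t κ⁻) = view(t₀) κ⁻, where t₀ is the prefix of t ending with the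
--                (last) justifier of κ⁻, or the empty sequence if none.
data View : List Action → List Action → Set where
  v-nil  : View [] []
  v-pos  : ∀ {t v κ} → Positive κ → View t v → View (t ++ [ κ ]) (v ++ [ κ ])
  v-init : ∀ {t κ} → Negative κ → NoJust κ t → View (t ++ [ κ ]) [ κ ]
  v-neg  : ∀ {u j w v κ} → Negative κ → Justifies j κ → NoJust κ w →
           View (u ++ [ j ]) v →
           View ((u ++ [ j ]) ++ w ++ [ κ ]) (v ++ [ κ ])

_≼ᵇ_ : Locus → Locus → Bool
[]      ≼ᵇ _       = true
(_ ∷ _) ≼ᵇ []      = false
(a ∷ s) ≼ᵇ (b ∷ t) = (a ≡ᵇ b) ∧ (s ≼ᵇ t)

cutᵇ : Locus → Action → Bool
cutᵇ σ (act _ ξ _) = σ ≼ᵇ ξ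
cutᵇ σ daimon      = false

cutPart : Locus → List Action → List Action
cutPart σ []      = []
cutPart σ (a ∷ s) = if cutᵇ σ a then a ∷ cutPart σ s else cutPart σ s

extPart : Locus → List Action → List Action
extPart σ []      = []
extPart σ (a ∷ s) = if cutᵇ σ a then extPart σ s else a ∷ extPart σ s

-- Whose turn it is in an interaction of a cut-net {D, E} with D on ⊢ σ
-- (positive) and E on σ ⊢ Λ (negative on σ): the design D, the design E,
-- or the environment (after a visible positive action of E).
data Turn : Set where
  turnD turnE turnEnv : Turn

-- Interaction sequences are written with the polarities of E.
-- Legal σ t s t' : starting at turn t, the sequence s is a well-turned
-- alternating sequence of proper actions ending at turn t'.
data Legal (σ : Locus) : Turn → List Action → Turn → Set where
  l-end    : ∀ {t} → Legal σ t [] t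
  l-D      : ∀ {ξ I s t'} → cutᵇ σ (act neg ξ I) ≡ true →
             Legal σ turnE s t' → Legal σ turnD (act neg ξ I ∷ s) t'
  l-Env    : ∀ {ξ I s t'} → cutᵇ σ (act neg ξ I) ≡ false →
             Legal σ turnE s t' → Legal σ turnEnv (act neg ξ I ∷ s) t'
  l-E-cut  : ∀ {ξ I s t'} → cutᵇ σ (act pos ξ I) ≡ true →
             Legal σ turnD s t' → Legal σ turnE (act pos ξ I ∷ s) t'
  l-E-ext  : ∀ {ξ I s t'} → cutᵇ σ (act pos ξ I) ≡ false →
             Legal σ turnEnv s t' → Legal σ turnE (act pos ξ I ∷ s) t'

record Path (σ : Locus) (D E : Design) (s : List Action) (t : Turn) : Set where
  field
    legal  : Legal σ turnD s t
    linear : Unique s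
    viewE  : ∀ p q → s ≡ p ++ q → Σ (List Action) λ v → View p v × E v
    viewD  : ∀ p q → s ≡ p ++ q →
             Σ (List Action) λ v → View (dualSeq (cutPart σ p)) v × D v

-- Maximal (positive-ended) chronicles produced by the interaction:
-- the view of the visible part of a path ending on a visible positive action
-- of E, possibly followed by a daimon played by E or D.
data Completed (σ : Locus) (D E : Design) : Chronicle → Set where
  c-vis : ∀ {s c} → Path σ D E s turnEnv → View (extPart σ s) c →
          Completed σ D E c
  c-daiE : ∀ {s c v} → Path σ D E s turnE → View (extPart σ s) c →
           View s v → E (v ++ [ daimon ]) →
           Completed σ D E (c ++ [ daimon ])
  c-daiD : ∀ {s c v} → Path σ D E s turnD → View (extPart σ s) c →
           View (dualSeq (cutPart σ s)) v → D (v ++ [ daimon ]) →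
           Completed σ D E (c ++ [ daimon ])

-- The normal form: all prefixes of completed chronicles (chronicles whose
-- interaction diverges are erased).
NormalForm : Locus → Design → Design → Design
NormalForm σ D E c = Σ Chronicle λ c' → Completed σ D E c' × IsPrefix c c'

data Net : Set₁ where
  single : (β : Locus) → Design → Net
  cutNet : (σ : Locus) → (D E : Design) → (β : Locus) → Net

baseOf : Net → Locus
baseOf (single β _)     = β
baseOf (cutNet _ _ _ β) = β

nf : Net → Design
nf (single _ D)     = D
nf (cutNet σ D E _) = NormalForm σ D E

HasCut : Net → Set
HasCut (single _ _)     = ⊥
HasCut (cutNet _ _ _ _) = ⊤

bar : ℕ → Locus
bar zero    = []
bar (suc n) = bar n ++ (0 ∷ 1 ∷ [])

-- the single maximal chronicle of 𝐧_σ
natChron : ℕ → Locus → Chronicle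
natChron zero    σ = [ act pos σ [] ]
natChron (suc n) σ = act pos σ [ 0 ] ∷ act neg (σ ∙ 0) [ 1 ] ∷ natChron n (σ ∙ 0 ∙ 1)

natD : ℕ → Locus → Design
natD n σ c = IsPrefix c (natChron n σ)

InNat : Locus → Design → Set
InNat β D = Σ ℕ λ k → D ≐ natD k β

TermOfNat : Net → Set
TermOfNat R = InNat (baseOf R) (nf R)

CanonicalTerm : Net → Set
CanonicalTerm R = TermOfNat R × ¬ HasCut R

NonCanonicalTerm : Net → Set
NonCanonicalTerm R = TermOfNat R × HasCut R

-- chronicles of 𝔉𝔞𝔵_{ξ ⊢ ξ'} restricted to ramifications satisfying R
-- 𝔉𝔞𝔵_{ξ⊢ξ'} = {(-,ξ,I)(+,ξ',I) 𝔉𝔞𝔵_{ξ'.i ⊢ ξ.i}}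
data FaxC (R : Ram → Set) : Locus → Locus → Chronicle → Set where
  f-nil  : ∀ {ξ ξ'} → FaxC R ξ ξ' []
  f-neg  : ∀ {ξ ξ' I} → R I → FaxC R ξ ξ' [ act neg ξ I ]
  f-pos  : ∀ {ξ ξ' I} → R I → FaxC R ξ ξ' (act neg ξ I ∷ act pos ξ' I ∷ [])
  f-step : ∀ {ξ ξ' I i c} → R I → i ∈ I → FaxC R (ξ' ∙ i) (ξ ∙ i) c →
           FaxC R ξ ξ' (act neg ξ I ∷ act pos ξ' I ∷ c)

-- the ramifications needed for interacting with (designs of) ℕat: ∅, {0}, {1}
NeededRam : Ram → Set
NeededRam I = I ≡ [] ⊎ I ≡ [ 0 ] ⊎ I ≡ [ 1 ]

IdC : Locus → Locus → Chronicle → Set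
IdC = FaxC NeededRam

suSteps : ℕ → Locus → Chronicle
suSteps zero    β = act pos β [ 0 ] ∷ act neg (β ∙ 0) [ 1 ] ∷ []
suSteps (suc n) β = act pos β [ 0 ] ∷ act neg (β ∙ 0) [ 1 ] ∷ suSteps n (β ∙ 0 ∙ 1)

suEnd : ℕ → Locus → Locus
suEnd zero    β = β ∙ 0 ∙ 1
suEnd (suc n) β = suEnd n (β ∙ 0 ∙ 1)

-- the part above {0} before Id:  (-,σ,{0}) suSteps (+,σ.0,{1})
suPre : ℕ → Locus → Locus → Chronicle
suPre n σ β = act neg σ [ 0 ] ∷ (suSteps n β ++ [ act pos (σ ∙ 0) [ 1 ] ])

SuD : ℕ → Locus → Locus → Design
SuD n σ β c =
  IsPrefix c (act neg σ [] ∷ natChron n β)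
  ⊎ IsPrefix c (suPre n σ β)
  ⊎ Σ Chronicle λ f → IdC (σ ∙ 0 ∙ 1) (suEnd n β) f × c ≡ suPre n σ β ++ f

DisjointLoci : Locus → Locus → Set
DisjointLoci σ β = ¬ (Σ Locus λ w → β ≡ σ ++ w) × ¬ (Σ Locus λ w → σ ≡ β ++ w)

module Submission where

-- The normal form of the cut-net {𝐦_σ, 𝔖𝔲_n} is computed by exhibiting its
-- canonical interaction `run m`: D = 𝐦_σ plays on σ, 𝔖𝔲_n answers with its
-- n+1 steps on β and then acts as the copycat Id between the rest of 𝐦 and
-- β.(n+1)‾.  Along this sequence D sees exactly 𝐦 (the dualised cut part)
-- while the environment sees 𝐦+𝐧 (the visible part).
--
-- Then, for disjoint σ and β, completeness: `run m` is
-- an interaction path whose visible part is 𝐦+𝐧; and soundness: every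
-- interaction path follows `run m`, up to a last external action not yet
-- answered (an action off the run would force 𝔖𝔲_n either to repeat an
-- action or to send D a ramification other than {1}), and nobody plays the
-- daimon.

open import Defs
open import Data.Nat using (ℕ; zero; suc; _+_; _≡ᵇ_) renaming (_≟_ to ℕ-≟)
open import Data.Nat.Properties using (+-comm; ≡ᵇ⇒≡; ≡⇒≡ᵇ)
open import Data.Bool using (true; false; _∧_)
open import Data.Bool.Properties using (T-≡)
open import Data.List using (List; []; _∷_; _++_; [_]; _∷ʳ_; map)
open import Data.List.Properties using (++-assoc; ++-identityʳ; ∷ʳ-injective; ≡-dec)
open import Data.List.Reverse using (Reverse; []; _∶_∶ʳ_; reverseView)
open import Data.List.Relation.Binary.Prefix.Heterogeneous using (Prefix; []; _∷_; _++ᵖ_)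
import Data.List.Relation.Binary.Prefix.Heterogeneous.Properties as Prefixₚ
import Data.List.Relation.Binary.Pointwise as Pointwise
open import Data.List.Relation.Unary.Any using (here)
open import Data.List.Membership.Propositional using (_∈_)
open import Data.List.Relation.Unary.All using (All; []; _∷_)
import Data.List.Relation.Unary.All as All
open import Data.List.Relation.Unary.All.Properties using (++⁻ˡ; ++⁻ʳ; ++⁺)
open import Data.List.Relation.Unary.Linked using (Linked; []; [-]; _∷_; tail)
open import Data.List.Relation.Unary.AllPairs using ([]; _∷_)
open import Data.List.Relation.Unary.Unique.Propositional using (Unique)
import Data.List.Relation.Unary.Unique.Propositional.Properties as Unique
open import Data.Product using (Σ; _×_; _,_; proj₁; proj₂)
open import Data.Sum using (_⊎_; inj₁; inj₂)
open import Data.Empty using (⊥; ⊥-elim)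
open import Data.Unit using (⊤; tt)
open import Function.Bundles using (Equivalence)
open import Relation.Nullary using (¬_; Dec; yes; no)
open import Relation.Binary.PropositionalEquality
  using (_≡_; refl; sym; trans; cong; cong₂; subst; module ≡-Reasoning)

-- Prefixes of lists

-- xs ⊑ ys : xs is an initial segment of ys (used both for chronicles and,
-- on loci, for "ys lies above xs").
_⊑_ : {A : Set} → List A → List A → Set
_⊑_ = Prefix _≡_

infix 4 _⊑_

module _ {A : Set} where

  ⊑-refl : (xs : List A) → xs ⊑ xs
  ⊑-refl []       = []
  ⊑-refl (x ∷ xs) = refl ∷ ⊑-refl xs

  ⊑-trans : {xs ys zs : List A} → xs ⊑ ys → ys ⊑ zs → xs ⊑ zs
  ⊑-trans = Prefixₚ.trans trans

  ⊑-++ : (xs ys : List A) → xs ⊑ xs ++ ys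
  ⊑-++ xs ys = ⊑-refl xs ++ᵖ ys

  ⊑-prepend : (zs : List A) {xs ys : List A} → xs ⊑ ys → zs ++ xs ⊑ zs ++ ys
  ⊑-prepend zs = Prefixₚ.++⁺ (Pointwise.refl refl)

  ⊑-unprepend : (zs : List A) {xs ys : List A} → zs ++ xs ⊑ zs ++ ys → xs ⊑ ys
  ⊑-unprepend zs = Prefixₚ.++⁻ refl

  ⊑-fromΣ : {xs ys : List A} → Σ (List A) (λ w → ys ≡ xs ++ w) → xs ⊑ ys
  ⊑-fromΣ {xs} (w , refl) = ⊑-++ xs w

  ⊑-toΣ : {xs ys : List A} → xs ⊑ ys → Σ (List A) (λ w → ys ≡ xs ++ w)
  ⊑-toΣ {ys = ys} [] = ys , refl
  ⊑-toΣ (refl ∷ p) with w , refl ← ⊑-toΣ p = w , refl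

  ⊑-no-proper : (xs : List A) {y : A} {ys : List A} → ¬ (xs ++ y ∷ ys ⊑ xs)
  ⊑-no-proper []       ()
  ⊑-no-proper (x ∷ xs) (refl ∷ p) = ⊑-no-proper xs p

  ⊑-comparable : {xs ys zs : List A} → xs ⊑ zs → ys ⊑ zs → xs ⊑ ys ⊎ ys ⊑ xs
  ⊑-comparable []         _          = inj₁ []
  ⊑-comparable (_ ∷ _)    []         = inj₂ []
  ⊑-comparable (refl ∷ p) (refl ∷ q) with ⊑-comparable p q
  ... | inj₁ r = inj₁ (refl ∷ r)
  ... | inj₂ r = inj₂ (refl ∷ r)

  ⊑-next-unique : (xs : List A) {y z : A} {zs : List A} →
                  xs ∷ʳ y ⊑ zs → xs ∷ʳ z ⊑ zs → y ≡ z
  ⊑-next-unique []       (refl ∷ _) (refl ∷ _) = refl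
  ⊑-next-unique (x ∷ xs) (refl ∷ p) (refl ∷ q) = ⊑-next-unique xs p q

  ⊑-grow : {xs zs : List A} → xs ⊑ zs → xs ≡ zs ⊎ Σ A (λ y → xs ∷ʳ y ⊑ zs)
  ⊑-grow {zs = []}    [] = inj₁ refl
  ⊑-grow {zs = z ∷ _} [] = inj₂ (z , refl ∷ [])
  ⊑-grow (refl ∷ p) with ⊑-grow p
  ... | inj₁ refl    = inj₁ refl
  ... | inj₂ (y , q) = inj₂ (y , refl ∷ q)

  ⊑-++-split : (xs : List A) {zs ys : List A} → zs ⊑ xs ++ ys →
               zs ⊑ xs ⊎ Σ (List A) (λ ws → zs ≡ xs ++ ws × ws ⊑ ys)
  ⊑-++-split []       {zs} p = inj₂ (zs , refl , p)
  ⊑-++-split (x ∷ xs) []     = inj₁ []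
  ⊑-++-split (x ∷ xs) (refl ∷ p) with ⊑-++-split xs p
  ... | inj₁ q                = inj₁ (refl ∷ q)
  ... | inj₂ (ws , refl , q)  = inj₂ (ws , refl , q)

  ⊑-reflexive : {xs ys : List A} → xs ≡ ys → xs ⊑ ys
  ⊑-reflexive {xs} refl = ⊑-refl xs

  unique-init : (xs : List A) {ys : List A} → Unique (xs ++ ys) → Unique xs
  unique-init []       _        = []
  unique-init (x ∷ xs) (a ∷ u) = ++⁻ˡ xs a ∷ unique-init xs u

  unique-last : (xs : List A) {x : A} (ws : List A) → ¬ Unique ((xs ++ x ∷ ws) ∷ʳ x)
  unique-last []       ws (x∉ ∷ _) with x≢x ∷ [] ← ++⁻ʳ ws x∉ = x≢x refl
  unique-last (y ∷ xs) ws (_ ∷ u)  = unique-last xs ws u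

  ∷ʳ-nonempty : (xs : List A) {x : A} → ¬ ([] ≡ xs ∷ʳ x)
  ∷ʳ-nonempty []      ()
  ∷ʳ-nonempty (_ ∷ _) ()

  -- If p ⊑ s and both s and p x are prefixes of L, then s x ⊑ L as soon as
  -- x does not occur in s: the extension of p by x has to happen at s.
  ⊑-linear-extend : {p s L : List A} {x : A} → p ⊑ s → s ⊑ L → p ∷ʳ x ⊑ L → Unique (s ∷ʳ x) →
                    s ∷ʳ x ⊑ L
  ⊑-linear-extend {p} {x = x} p⊑s s⊑L px⊑L u with ⊑-grow p⊑s
  ... | inj₁ refl = px⊑L
  ... | inj₂ (y , py⊑s) with refl ← ⊑-next-unique p (⊑-trans py⊑s s⊑L) px⊑L
                        with w , refl ← ⊑-toΣ py⊑s =
    ⊥-elim (unique-last p w (subst (λ z → Unique (z ∷ʳ x)) (++-assoc p [ x ] w) u))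

  all-⊑ : {P : A → Set} {xs ys : List A} → xs ⊑ ys → All P ys → All P xs
  all-⊑ []         _        = []
  all-⊑ (refl ∷ p) (px ∷ a) = px ∷ all-⊑ p a

  all-last : {P : A → Set} (xs : List A) {x : A} → All P (xs ∷ʳ x) → P x
  all-last xs p with px ∷ [] ← ++⁻ʳ xs p = px

≼ᵇ-complete : {σ ξ : Locus} → σ ⊑ ξ → (σ ≼ᵇ ξ) ≡ true
≼ᵇ-complete []                       = refl
≼ᵇ-complete (_∷_ {a} refl p) =
  cong₂ _∧_ (Equivalence.to T-≡ (≡⇒≡ᵇ a a refl)) (≼ᵇ-complete p)

≼ᵇ-sound : (σ ξ : Locus) → (σ ≼ᵇ ξ) ≡ true → σ ⊑ ξ
≼ᵇ-sound []      ξ       _ = []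
≼ᵇ-sound (a ∷ σ) []      ()
≼ᵇ-sound (a ∷ σ) (b ∷ ξ) e with a ≡ᵇ b in a≡ᵇb
... | true  = ≡ᵇ⇒≡ a b (Equivalence.from T-≡ a≡ᵇb) ∷ ≼ᵇ-sound σ ξ e
... | false with () ← e

-- Views of immediately justified sequences

pos-not-neg : {κ : Action} → Positive κ → ¬ Negative κ
pos-not-neg p-act ()

JustifiedByPrevious : Action → Action → Set
JustifiedByPrevious x y = Negative y → Justifies x y

ImmJust : List Action → Set
ImmJust = Linked JustifiedByPrevious

immJust-prefix : (s : List Action) {r : List Action} → ImmJust (s ++ r) → ImmJust s
immJust-prefix []          _       = []
immJust-prefix (x ∷ [])    _       = [-]
immJust-prefix (x ∷ y ∷ s) (j ∷ l) = j ∷ immJust-prefix (y ∷ s) l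

immJust-suffix : (s : List Action) {r : List Action} → ImmJust (s ++ r) → ImmJust r
immJust-suffix []      l = l
immJust-suffix (x ∷ s) l = immJust-suffix s (tail l)

immJust-⊑ : {s r : List Action} → s ⊑ r → ImmJust r → ImmJust s
immJust-⊑ {s} p l with w , refl ← ⊑-toΣ p = immJust-prefix s l

immJust-last : (u : List Action) {j κ : Action} → ImmJust ((u ∷ʳ j) ∷ʳ κ) →
               Negative κ → Justifies j κ
immJust-last u {j} {κ} l
  with j⊢κ ∷ _ ← immJust-suffix u (subst ImmJust (++-assoc u [ j ] [ κ ]) l) = j⊢κ

immJust-initial : (t : List Action) {κ : Action} → ImmJust (t ∷ʳ κ) →
                  Negative κ → NoJust κ t → t ≡ []
immJust-initial []          _       _  _         = refl
immJust-initial (x ∷ [])    (j ∷ _) nκ (nj ∷ []) = ⊥-elim (nj (j nκ))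
immJust-initial (x ∷ y ∷ t) (_ ∷ l) nκ (_ ∷ nj) with () ← immJust-initial (y ∷ t) l nκ nj

view-immJust : {t v : List Action} → ImmJust t → View t v → v ≡ t
view-immJust l v-nil = refl
view-immJust l (v-pos {t} {κ = κ} _ vw) = cong (_∷ʳ κ) (view-immJust (immJust-prefix t l) vw)
view-immJust l (v-init {t} nκ nj) with refl ← immJust-initial t l nκ nj = refl
view-immJust l (v-neg {u} {j} {w} {κ = κ} nκ _ nj vw)
  with refl ← immJust-initial w (immJust-suffix (u ∷ʳ j) l) nκ nj
  = cong (_∷ʳ κ) (view-immJust (immJust-prefix (u ∷ʳ j) l) vw)

view-immJust-neg : {X v t : List Action} {κ : Action} → ImmJust t → Negative κ →
                   View X v → X ≡ t ∷ʳ κ → Σ (List Action) λ p → p ⊑ t × v ≡ p ∷ʳ κ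
view-immJust-neg {t = t} _ _ v-nil e = ⊥-elim (∷ʳ-nonempty t e)
view-immJust-neg {t = t} _ nκ (v-pos {t'} pκ _) e with refl , refl ← ∷ʳ-injective t' t e =
  ⊥-elim (pos-not-neg pκ nκ)
view-immJust-neg {t = t} _ _ (v-init {t'} _ _) e with refl , refl ← ∷ʳ-injective t' t e =
  [] , [] , refl
view-immJust-neg {t = t} l _ (v-neg {u} {j} {w} _ _ _ vw) e
  with refl , refl ← ∷ʳ-injective ((u ∷ʳ j) ++ w) t (trans (++-assoc (u ∷ʳ j) w _) e)
  with refl ← view-immJust (immJust-prefix (u ∷ʳ j) l) vw
  = u ∷ʳ j , ⊑-++ (u ∷ʳ j) w , refl

immJust-view : (t : List Action) → ImmJust t → View t t
immJust-view t = go (reverseView t)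
  where
  go : {t : List Action} → Reverse t → ImmJust t → View t t
  go [] _ = v-nil
  go (u ∶ r ∶ʳ act pos ξ I) l = v-pos p-act (go r (immJust-prefix u l))
  go (u ∶ r ∶ʳ daimon)      l = v-pos p-dai (go r (immJust-prefix u l))
  go (.[] ∶ [] ∶ʳ act neg ξ I) l = v-init n-act []
  go (.(u ∷ʳ j) ∶ (u ∶ r ∶ʳ j) ∶ʳ act neg ξ I) l =
    v-neg n-act (immJust-last u l n-act) [] (go (u ∶ r ∶ʳ j) (immJust-prefix (u ∷ʳ j) l))

-- Views are taken action by action: they end with the last action.  (Here
-- and below the viewed sequence X is given up to an equation, since the
-- view rules index it with different bracketings.)
view-last : {X v t : List Action} {κ : Action} → View X v → X ≡ t ∷ʳ κ →
            Σ (List Action) λ q → v ≡ q ∷ʳ κ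
view-last {t = t} v-nil e = ⊥-elim (∷ʳ-nonempty t e)
view-last {t = t} (v-pos {t'} {v'} _ _) e with refl , refl ← ∷ʳ-injective t' t e = v' , refl
view-last {t = t} (v-init {t'} _ _) e with refl , refl ← ∷ʳ-injective t' t e = [] , refl
view-last {t = t} (v-neg {u} {j} {w} {v'} _ _ _ _) e
  with refl , refl ← ∷ʳ-injective ((u ∷ʳ j) ++ w) t (trans (++-assoc (u ∷ʳ j) w _) e) = v' , refl

view-pos : {X v t : List Action} {κ : Action} → View X v → X ≡ t ∷ʳ κ → Positive κ →
           Σ (List Action) λ v' → View t v' × v ≡ v' ∷ʳ κ
view-pos {t = t} v-nil e _ = ⊥-elim (∷ʳ-nonempty t e)
view-pos {t = t} (v-pos {t'} {v'} _ vw) e _ with refl , refl ← ∷ʳ-injective t' t e = v' , vw , refl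
view-pos {t = t} (v-init {t'} nκ _) e pκ with refl , refl ← ∷ʳ-injective t' t e =
  ⊥-elim (pos-not-neg pκ nκ)
view-pos {t = t} (v-neg {u} {j} {w} nκ _ _ _) e pκ
  with refl , refl ← ∷ʳ-injective ((u ∷ʳ j) ++ w) t (trans (++-assoc (u ∷ʳ j) w _) e) =
  ⊥-elim (pos-not-neg pκ nκ)

-- The internal and visible parts of a sequence

true≢false : ¬ (true ≡ false)
true≢false ()

cutPart-++ : (σ : Locus) (xs ys : List Action) → cutPart σ (xs ++ ys) ≡ cutPart σ xs ++ cutPart σ ys
cutPart-++ σ []       ys = refl
cutPart-++ σ (x ∷ xs) ys with cutᵇ σ x
... | true  = cong (x ∷_) (cutPart-++ σ xs ys)
... | false = cutPart-++ σ xs ys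

extPart-++ : (σ : Locus) (xs ys : List Action) → extPart σ (xs ++ ys) ≡ extPart σ xs ++ extPart σ ys
extPart-++ σ []       ys = refl
extPart-++ σ (x ∷ xs) ys with cutᵇ σ x
... | true  = extPart-++ σ xs ys
... | false = cong (x ∷_) (extPart-++ σ xs ys)

dualSeq-++ : (xs ys : List Action) → dualSeq (xs ++ ys) ≡ dualSeq xs ++ dualSeq ys
dualSeq-++ []       ys = refl
dualSeq-++ (x ∷ xs) ys = cong (dual x ∷_) (dualSeq-++ xs ys)

-- what the positive design D of a cut-net sees of a sequence: its cut part,
-- with polarities reversed
dualCut : Locus → List Action → List Action
dualCut σ s = dualSeq (cutPart σ s)

dualCut-++ : (σ : Locus) (xs ys : List Action) → dualCut σ (xs ++ ys) ≡ dualCut σ xs ++ dualCut σ ys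
dualCut-++ σ xs ys = trans (cong dualSeq (cutPart-++ σ xs ys)) (dualSeq-++ (cutPart σ xs) (cutPart σ ys))

dualCut-∷ʳ : (σ : Locus) (xs : List Action) {x : Action} → cutᵇ σ x ≡ true →
             dualCut σ (xs ∷ʳ x) ≡ dualCut σ xs ∷ʳ dual x
dualCut-∷ʳ σ xs {x} cut =
  trans (dualCut-++ σ xs [ x ]) (cong (λ c → dualCut σ xs ++ dualSeq c) (cut-singleton cut))
  where
  cut-singleton : cutᵇ σ x ≡ true → cutPart σ [ x ] ≡ [ x ]
  cut-singleton cut rewrite cut = refl

unique-parts : (σ : Locus) (s : List Action) → Unique (cutPart σ s) → Unique (extPart σ s) → Unique s
unique-parts σ []      _  _  = []
unique-parts σ (x ∷ s) uc ue with cutᵇ σ x in cx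
... | true  with x∉ ∷ uc′ ← uc = fromCut s x∉ ∷ unique-parts σ s uc′ ue
  where
  fromCut : (s : List Action) → All (λ y → ¬ x ≡ y) (cutPart σ s) → All (λ y → ¬ x ≡ y) s
  fromCut []      _ = []
  fromCut (y ∷ s) a with cutᵇ σ y in cy
  fromCut (y ∷ s) (x≢y ∷ a) | true = x≢y ∷ fromCut s a
  fromCut (y ∷ s) a         | false = (λ { refl → true≢false (trans (sym cx) cy) }) ∷ fromCut s a
... | false with x∉ ∷ ue′ ← ue = fromExt s x∉ ∷ unique-parts σ s uc ue′
  where
  fromExt : (s : List Action) → All (λ y → ¬ x ≡ y) (extPart σ s) → All (λ y → ¬ x ≡ y) s
  fromExt []      _ = []
  fromExt (y ∷ s) a with cutᵇ σ y in cy
  fromExt (y ∷ s) a         | true = (λ { refl → true≢false (trans (sym cy) cx) }) ∷ fromExt s a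
  fromExt (y ∷ s) (x≢y ∷ a) | false = x≢y ∷ fromExt s a

unique-dualSeq : (xs : List Action) → Unique (dualSeq xs) → Unique xs
unique-dualSeq xs u = Unique.map⁻ (subst Unique (dualSeq-map xs) u)
  where
  dualSeq-map : (xs : List Action) → dualSeq xs ≡ map dual xs
  dualSeq-map [] = refl
  dualSeq-map (x ∷ xs) = cong (dual x ∷_) (dualSeq-map xs)

legal-++ : {σ : Locus} {t t₁ t₂ : Turn} {s r : List Action} →
           Legal σ t s t₁ → Legal σ t₁ r t₂ → Legal σ t (s ++ r) t₂
legal-++ l-end         l = l
legal-++ (l-D c l)     k = l-D c (legal-++ l k)
legal-++ (l-Env c l)   k = l-Env c (legal-++ l k)
legal-++ (l-E-cut c l) k = l-E-cut c (legal-++ l k)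
legal-++ (l-E-ext c l) k = l-E-ext c (legal-++ l k)

legal-split : {σ : Locus} {t t₂ : Turn} (s : List Action) {r : List Action} →
              Legal σ t (s ++ r) t₂ → Σ Turn λ t₁ → Legal σ t s t₁ × Legal σ t₁ r t₂
legal-split {t = t} [] l = t , l-end , l
legal-split (x ∷ s) (l-D c l)     with t₁ , l₁ , l₂ ← legal-split s l = t₁ , l-D c l₁ , l₂
legal-split (x ∷ s) (l-Env c l)   with t₁ , l₁ , l₂ ← legal-split s l = t₁ , l-Env c l₁ , l₂
legal-split (x ∷ s) (l-E-cut c l) with t₁ , l₁ , l₂ ← legal-split s l = t₁ , l-E-cut c l₁ , l₂
legal-split (x ∷ s) (l-E-ext c l) with t₁ , l₁ , l₂ ← legal-split s l = t₁ , l-E-ext c l₁ , l₂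

legal-turn-unique : {σ : Locus} {t t₁ t₂ : Turn} {s : List Action} →
                    Legal σ t s t₁ → Legal σ t s t₂ → t₁ ≡ t₂
legal-turn-unique l-end         l-end         = refl
legal-turn-unique (l-D _ l)     (l-D _ k)     = legal-turn-unique l k
legal-turn-unique (l-Env _ l)   (l-Env _ k)   = legal-turn-unique l k
legal-turn-unique (l-E-cut _ l) (l-E-cut _ k) = legal-turn-unique l k
legal-turn-unique (l-E-ext _ l) (l-E-ext _ k) = legal-turn-unique l k
legal-turn-unique (l-E-cut c _) (l-E-ext c′ _) = ⊥-elim (true≢false (trans (sym c) c′))
legal-turn-unique (l-E-ext c _) (l-E-cut c′ _) = ⊥-elim (true≢false (trans (sym c′) c))

-- Chronicles of the numerals

LocatedAbove : Locus → Action → Set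
LocatedAbove ζ (act _ ξ _) = ζ ⊑ ξ
LocatedAbove ζ daimon      = ⊥

⊑-∙ : {ζ ξ : Locus} (i : ℕ) → ζ ⊑ ξ → ζ ⊑ ξ ∙ i
⊑-∙ i p = p ++ᵖ [ i ]

⊑-∙01 : (ζ : Locus) → ζ ⊑ ζ ∙ 0 ∙ 1
⊑-∙01 ζ = ⊑-∙ 1 (⊑-∙ 0 (⊑-refl ζ))

located-mono : {ζ ξ : Locus} (a : Action) → ζ ⊑ ξ → LocatedAbove ξ a → LocatedAbove ζ a
located-mono (act _ _ _) p q = ⊑-trans p q

natChron-located : (k : ℕ) (ζ : Locus) → All (LocatedAbove ζ) (natChron k ζ)
natChron-located zero    ζ = ⊑-refl ζ ∷ []
natChron-located (suc k) ζ = ⊑-refl ζ ∷ ⊑-∙ 0 (⊑-refl ζ) ∷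
  All.map (λ {a} → located-mono a (⊑-∙01 ζ)) (natChron-located k (ζ ∙ 0 ∙ 1))

natChron-unique : (k : ℕ) (ζ : Locus) → Unique (natChron k ζ)
natChron-unique zero    ζ = [] ∷ []
natChron-unique (suc k) ζ =
  ((λ ()) ∷ All.map (λ {a} → ≢-root a) above) ∷ All.map (λ {a} → ≢-second a) above ∷
  natChron-unique k (ζ ∙ 0 ∙ 1)
  where
  above : All (LocatedAbove (ζ ∙ 0 ∙ 1)) (natChron k (ζ ∙ 0 ∙ 1))
  above = natChron-located k (ζ ∙ 0 ∙ 1)
  -- the remaining actions lie strictly above the first two
  ≢-root : (a : Action) → LocatedAbove (ζ ∙ 0 ∙ 1) a → ¬ act pos ζ [ 0 ] ≡ a
  ≢-root _ p refl = ⊑-no-proper ζ (subst (_⊑ ζ) (++-assoc ζ [ 0 ] [ 1 ]) p)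
  ≢-second : (a : Action) → LocatedAbove (ζ ∙ 0 ∙ 1) a → ¬ act neg (ζ ∙ 0) [ 1 ] ≡ a
  ≢-second _ p refl = ⊑-no-proper (ζ ∙ 0) p

StartsPositive : List Action → Set
StartsPositive []      = ⊤
StartsPositive (a ∷ _) = Positive a

immJust-∷ : (x : Action) {s : List Action} → StartsPositive s → ImmJust s → ImmJust (x ∷ s)
immJust-∷ x {[]}    _  _ = [-]
immJust-∷ x {_ ∷ _} p  l = (λ n → ⊥-elim (pos-not-neg p n)) ∷ l

natChron-startsPositive : (k : ℕ) (ζ : Locus) → StartsPositive (natChron k ζ)
natChron-startsPositive zero    ζ = p-act
natChron-startsPositive (suc k) ζ = p-act

natChron-immJust : (k : ℕ) (ζ : Locus) → ImmJust (natChron k ζ)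
natChron-immJust zero    ζ = [-]
natChron-immJust (suc k) ζ = (λ _ → just (here refl)) ∷
  immJust-∷ _ (natChron-startsPositive k _) (natChron-immJust k (ζ ∙ 0 ∙ 1))

RamOneIfNegative : Action → Set
RamOneIfNegative (act neg _ J) = J ≡ [ 1 ]
RamOneIfNegative _             = ⊤

natChron-ramOne : (k : ℕ) (ζ : Locus) → All RamOneIfNegative (natChron k ζ)
natChron-ramOne zero    ζ = tt ∷ []
natChron-ramOne (suc k) ζ = tt ∷ refl ∷ natChron-ramOne k (ζ ∙ 0 ∙ 1)

Proper : Action → Set
Proper (act _ _ _) = ⊤
Proper daimon      = ⊥

located-proper : {ζ : Locus} (a : Action) → LocatedAbove ζ a → Proper a
located-proper (act _ _ _) _ = tt

proper-∷ʳ-daimon : (v : List Action) {L : List Action} → v ∷ʳ daimon ⊑ L → ¬ All Proper L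
proper-∷ʳ-daimon v p a = all-last v (all-⊑ p a)

-- The copycat trace of Id against a numeral

-- The interaction of Id on ξ ⊢ ξ' with a numeral k played on ξ:
-- Id copies each action of the numeral from ξ to ξ' and back.
mutual
  copycat : ℕ → Locus → Locus → Chronicle
  copycat zero    ξ ξ' = act neg ξ [] ∷ act pos ξ' [] ∷ []
  copycat (suc k) ξ ξ' = act neg ξ [ 0 ] ∷ act pos ξ' [ 0 ] ∷ copycat′ k ξ ξ'

  copycat′ : ℕ → Locus → Locus → Chronicle
  copycat′ k ξ ξ' = act neg (ξ' ∙ 0) [ 1 ] ∷ act pos (ξ ∙ 0) [ 1 ] ∷ copycat k (ξ ∙ 0 ∙ 1) (ξ' ∙ 0 ∙ 1)

copycat-Id : (k : ℕ) (ξ ξ' : Locus) {z : Chronicle} → z ⊑ copycat k ξ ξ' → IdC ξ ξ' z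
copycat-Id zero    ξ ξ' []                         = f-nil
copycat-Id zero    ξ ξ' (refl ∷ [])                = f-neg (inj₁ refl)
copycat-Id zero    ξ ξ' (refl ∷ refl ∷ [])         = f-pos (inj₁ refl)
copycat-Id (suc k) ξ ξ' []                         = f-nil
copycat-Id (suc k) ξ ξ' (refl ∷ [])                = f-neg (inj₂ (inj₁ refl))
copycat-Id (suc k) ξ ξ' (refl ∷ refl ∷ p)          =
  f-step (inj₂ (inj₁ refl)) (here refl) (back p)
  where
  back : {z : Chronicle} → z ⊑ copycat′ k ξ ξ' → IdC (ξ' ∙ 0) (ξ ∙ 0) z
  back []                = f-nil
  back (refl ∷ [])       = f-neg (inj₂ (inj₂ refl))
  back (refl ∷ refl ∷ q) = f-step (inj₂ (inj₂ refl)) (here refl) (copycat-Id k _ _ q)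

fax-inv : {R : Ram → Set} {ξ ξ' : Locus} {x y : Action} {q : Chronicle} →
          FaxC R ξ ξ' (x ∷ y ∷ q) →
          Σ Ram λ I → x ≡ act neg ξ I × y ≡ act pos ξ' I ×
            (q ≡ [] ⊎ Σ ℕ λ i → i ∈ I × FaxC R (ξ' ∙ i) (ξ ∙ i) q)
fax-inv (f-pos {I = I} _)               = I , refl , refl , inj₁ refl
fax-inv (f-step {I = I} {i = i} _ i∈ c) = I , refl , refl , inj₂ (i , i∈ , c)

mutual
  copycat-answer : {R : Ram → Set} (k : ℕ) (ξ ξ' : Locus) (c : Chronicle) {a : Action} →
                   FaxC R ξ ξ' (c ∷ʳ a) → c ⊑ copycat k ξ ξ' → Positive a →
                   c ∷ʳ a ⊑ copycat k ξ ξ'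
  copycat-answer k       ξ ξ' []      (f-neg _) [] ()
  copycat-answer zero    ξ ξ' (x ∷ []) f (refl ∷ []) _ with _ , refl , refl , _ ← fax-inv f =
    refl ∷ refl ∷ []
  copycat-answer (suc k) ξ ξ' (x ∷ []) f (refl ∷ []) _ with _ , refl , refl , _ ← fax-inv f =
    refl ∷ refl ∷ []
  copycat-answer zero    ξ ξ' (x ∷ y ∷ []) f (refl ∷ refl ∷ []) _ with fax-inv f
  ... | _ , refl , refl , inj₂ (_ , () , _)
  copycat-answer (suc k) ξ ξ' (x ∷ y ∷ c) f (refl ∷ refl ∷ p) pa with fax-inv f
  ... | _ , refl , refl , inj₁ e                  = ⊥-elim (∷ʳ-nonempty c (sym e))
  ... | _ , refl , refl , inj₂ (_ , here refl , f′) = refl ∷ refl ∷ copycat-answer′ k ξ ξ' c f′ p pa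

  copycat-answer′ : {R : Ram → Set} (k : ℕ) (ξ ξ' : Locus) (c : Chronicle) {a : Action} →
                    FaxC R (ξ' ∙ 0) (ξ ∙ 0) (c ∷ʳ a) → c ⊑ copycat′ k ξ ξ' → Positive a →
                    c ∷ʳ a ⊑ copycat′ k ξ ξ'
  copycat-answer′ k ξ ξ' []       (f-neg _) [] ()
  copycat-answer′ k ξ ξ' (x ∷ []) f (refl ∷ []) _ with _ , refl , refl , _ ← fax-inv f =
    refl ∷ refl ∷ []
  copycat-answer′ k ξ ξ' (x ∷ y ∷ c) f (refl ∷ refl ∷ p) pa with fax-inv f
  ... | _ , refl , refl , inj₁ e                  = ⊥-elim (∷ʳ-nonempty c (sym e))
  ... | _ , refl , refl , inj₂ (_ , here refl , f′) =
    refl ∷ refl ∷ copycat-answer k (ξ ∙ 0 ∙ 1) (ξ' ∙ 0 ∙ 1) c f′ p pa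

fax-proper : {R : Ram → Set} {ξ ξ' : Locus} {c : Chronicle} → FaxC R ξ ξ' c → All Proper c
fax-proper f-nil          = []
fax-proper (f-neg _)      = tt ∷ []
fax-proper (f-pos _)      = tt ∷ tt ∷ []
fax-proper (f-step _ _ f) = tt ∷ tt ∷ fax-proper f

-- A positive action ≼ᵇ-complete the cut on σ whose ramification is not {1}:
-- a numeral played on σ can never accept it.
DeviantCut : Locus → Action → Set
DeviantCut σ a = Σ Locus λ ζ → Σ Ram λ J → a ≡ act pos ζ J × σ ⊑ ζ × ¬ J ≡ [ 1 ]

_≟ᴿ_ : (I J : Ram) → Dec (I ≡ J)
_≟ᴿ_ = ≡-dec ℕ-≟

mutual
  copycat-deviation :
    {R : Ram → Set} (σ : Locus) (k : ℕ) (ξ ξ' : Locus) (z : Chronicle) {ζ : Locus} {J : Ram} {a : Action} →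
    FaxC R ξ ξ' ((z ∷ʳ act neg ζ J) ∷ʳ a) → σ ⊑ ξ → z ⊑ copycat k ξ ξ' →
    cutᵇ σ (act neg ζ J) ≡ false →
    z ∷ʳ act neg ζ J ⊑ copycat k ξ ξ' ⊎ DeviantCut σ a
  copycat-deviation σ k ξ ξ' [] f σ⊑ξ [] ext with _ , refl , refl , _ ← fax-inv f =
    ⊥-elim (true≢false (trans (sym (≼ᵇ-complete σ⊑ξ)) ext))
  copycat-deviation σ zero    ξ ξ' (x ∷ []) f _ (refl ∷ []) _ with fax-inv f
  ... | _ , refl , () , _
  copycat-deviation σ (suc k) ξ ξ' (x ∷ []) f _ (refl ∷ []) _ with fax-inv f
  ... | _ , refl , () , _
  copycat-deviation σ zero    ξ ξ' (x ∷ y ∷ []) f _ (refl ∷ refl ∷ []) _ with fax-inv f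
  ... | _ , refl , refl , inj₂ (_ , () , _)
  copycat-deviation σ (suc k) ξ ξ' (x ∷ y ∷ z) f σ⊑ξ (refl ∷ refl ∷ p) ext with fax-inv f
  ... | _ , refl , refl , inj₁ e = ⊥-elim (∷ʳ-nonempty (z ∷ʳ _) (sym e))
  ... | _ , refl , refl , inj₂ (_ , here refl , f′) with copycat-deviation′ σ k ξ ξ' z f′ σ⊑ξ p ext
  ...   | inj₁ q = inj₁ (refl ∷ refl ∷ q)
  ...   | inj₂ d = inj₂ d

  copycat-deviation′ :
    {R : Ram → Set} (σ : Locus) (k : ℕ) (ξ ξ' : Locus) (z : Chronicle) {ζ : Locus} {J : Ram} {a : Action} →
    FaxC R (ξ' ∙ 0) (ξ ∙ 0) ((z ∷ʳ act neg ζ J) ∷ʳ a) → σ ⊑ ξ → z ⊑ copycat′ k ξ ξ' →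
    cutᵇ σ (act neg ζ J) ≡ false →
    z ∷ʳ act neg ζ J ⊑ copycat′ k ξ ξ' ⊎ DeviantCut σ a
  copycat-deviation′ σ k ξ ξ' [] f σ⊑ξ [] _ with fax-inv f
  ... | I , refl , refl , _ with I ≟ᴿ [ 1 ]
  ...   | yes refl = inj₁ (refl ∷ [])
  ...   | no I≢1   = inj₂ (ξ ∙ 0 , I , refl , ⊑-∙ 0 σ⊑ξ , I≢1)
  copycat-deviation′ σ k ξ ξ' (x ∷ []) f _ (refl ∷ []) _ with fax-inv f
  ... | _ , refl , () , _
  copycat-deviation′ σ k ξ ξ' (x ∷ y ∷ z) f σ⊑ξ (refl ∷ refl ∷ p) ext with fax-inv f
  ... | _ , refl , refl , inj₁ e = ⊥-elim (∷ʳ-nonempty (z ∷ʳ _) (sym e))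
  ... | _ , refl , refl , inj₂ (_ , here refl , f′)
    with copycat-deviation σ k (ξ ∙ 0 ∙ 1) (ξ' ∙ 0 ∙ 1) z f′ (⊑-∙ 1 (⊑-∙ 0 σ⊑ξ)) p ext
  ...   | inj₁ q = inj₁ (refl ∷ refl ∷ q)
  ...   | inj₂ d = inj₂ d

-- Chronicles of 𝔖𝔲_n

suSteps-located : (k : ℕ) (ζ : Locus) → All (LocatedAbove ζ) (suSteps k ζ)
suSteps-located zero    ζ = ⊑-refl ζ ∷ ⊑-∙ 0 (⊑-refl ζ) ∷ []
suSteps-located (suc k) ζ = ⊑-refl ζ ∷ ⊑-∙ 0 (⊑-refl ζ) ∷
  All.map (λ {a} → located-mono a (⊑-∙01 ζ)) (suSteps-located k (ζ ∙ 0 ∙ 1))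

suEnd-above : (k : ℕ) (ζ : Locus) → ζ ⊑ suEnd k ζ
suEnd-above zero    ζ = ⊑-∙01 ζ
suEnd-above (suc k) ζ = ⊑-trans (⊑-∙01 ζ) (suEnd-above k (ζ ∙ 0 ∙ 1))

suSteps-natChron : (k : ℕ) (ζ : Locus) (j : ℕ) →
                   suSteps k ζ ++ natChron j (suEnd k ζ) ≡ natChron (suc k + j) ζ
suSteps-natChron zero    ζ j = refl
suSteps-natChron (suc k) ζ j = cong (λ c → act pos ζ [ 0 ] ∷ act neg (ζ ∙ 0) [ 1 ] ∷ c)
                                    (suSteps-natChron k (ζ ∙ 0 ∙ 1) j)

suSteps-startsPositive : (k : ℕ) {ζ : Locus} {r : List Action} → StartsPositive (suSteps k ζ ++ r)
suSteps-startsPositive zero    = p-act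
suSteps-startsPositive (suc k) = p-act

suSteps-immJust : (k : ℕ) (ζ : Locus) {r : List Action} → StartsPositive r → ImmJust r →
                  ImmJust (suSteps k ζ ++ r)
suSteps-immJust zero    ζ p l = (λ _ → just (here refl)) ∷ immJust-∷ _ p l
suSteps-immJust (suc k) ζ p l =
  (λ _ → just (here refl)) ∷ immJust-∷ _ (suSteps-startsPositive k) (suSteps-immJust k _ p l)

copycat-immJust : (k : ℕ) (ζ ξ' : Locus) → ImmJust (act pos ζ [ 1 ] ∷ copycat k (ζ ∙ 1) ξ')
copycat-immJust zero    ζ ξ' = (λ _ → just (here refl)) ∷ (λ ()) ∷ [-]
copycat-immJust (suc k) ζ ξ' = (λ _ → just (here refl)) ∷ (λ ()) ∷ (λ _ → just (here refl)) ∷ (λ ()) ∷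
  copycat-immJust k (ζ ∙ 1 ∙ 0) (ξ' ∙ 0 ∙ 1)

-- The cut-net {𝐦_σ, 𝔖𝔲_n} and its canonical interaction

module Interaction (σ β : Locus) (disjoint : DisjointLoci σ β) (n : ℕ) where

  outside : {ξ : Locus} → β ⊑ ξ → (σ ≼ᵇ ξ) ≡ false
  outside {ξ} β⊑ξ with σ ≼ᵇ ξ in σ≼ξ
  ... | false = refl
  ... | true with ⊑-comparable (≼ᵇ-sound σ ξ σ≼ξ) β⊑ξ
  ...   | inj₁ σ⊑β = ⊥-elim (proj₁ disjoint (⊑-toΣ σ⊑β))
  ...   | inj₂ β⊑σ = ⊥-elim (proj₂ disjoint (⊑-toΣ β⊑σ))

  visible-parts : {ζ : Locus} → β ⊑ ζ → (xs : List Action) → All (LocatedAbove ζ) xs →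
                  cutPart σ xs ≡ [] × extPart σ xs ≡ xs
  visible-parts _   []                 []      = refl , refl
  visible-parts β⊑ζ (act p ξ I ∷ xs)   (ζ⊑ξ ∷ a)
    rewrite outside (⊑-trans β⊑ζ ζ⊑ξ) with c , e ← visible-parts β⊑ζ xs a = c , cong (_ ∷_) e

  copycat-parts : (k : ℕ) {ξ ξ' : Locus} → σ ⊑ ξ → β ⊑ ξ' →
                  dualCut σ (copycat k ξ ξ') ≡ natChron k ξ × extPart σ (copycat k ξ ξ') ≡ natChron k ξ'
  copycat-parts zero    σ⊑ξ β⊑ξ' rewrite ≼ᵇ-complete σ⊑ξ | outside β⊑ξ' = refl , refl
  copycat-parts (suc k) σ⊑ξ β⊑ξ'
    rewrite ≼ᵇ-complete σ⊑ξ | outside β⊑ξ' | outside (⊑-∙ 0 β⊑ξ') | ≼ᵇ-complete (⊑-∙ 0 σ⊑ξ)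
    with c , e ← copycat-parts k (⊑-∙ 1 (⊑-∙ 0 σ⊑ξ)) (⊑-∙ 1 (⊑-∙ 0 β⊑ξ'))
    = cong (λ r → _ ∷ _ ∷ r) c , cong (λ r → _ ∷ _ ∷ r) e

  pre : Chronicle
  pre = suPre n σ β

  -- The canonical interaction of {𝐦_σ, 𝔖𝔲_n}: for m = 0 D plays (+,σ,∅)
  -- and 𝔖𝔲_n answers with 𝐧 on β; for m = k+1 D plays (+,σ,{0}), 𝔖𝔲_n
  -- plays its n+1 steps on β, hands back on σ.0.1 and then acts as the
  -- copycat between the rest 𝐤 of D and β.(n+1)‾.
  run : ℕ → Chronicle
  run zero    = act neg σ [] ∷ natChron n β
  run (suc k) = pre ++ copycat k (σ ∙ 0 ∙ 1) (suEnd n β)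

  private
    σ⊑σ01 : σ ⊑ σ ∙ 0 ∙ 1
    σ⊑σ01 = ⊑-∙01 σ

    β⊑end : β ⊑ suEnd n β
    β⊑end = suEnd-above n β

    steps-visible : cutPart σ (suSteps n β) ≡ [] × extPart σ (suSteps n β) ≡ suSteps n β
    steps-visible = visible-parts (⊑-refl β) _ (suSteps-located n β)

    nat-visible : cutPart σ (natChron n β) ≡ [] × extPart σ (natChron n β) ≡ natChron n β
    nat-visible = visible-parts (⊑-refl β) _ (natChron-located n β)

    suPre-cut : (r : List Action) → cutPart σ (pre ++ r) ≡
                act neg σ [ 0 ] ∷ act pos (σ ∙ 0) [ 1 ] ∷ cutPart σ r
    suPre-cut r rewrite ≼ᵇ-complete (⊑-refl σ) | ++-assoc (suSteps n β) [ act pos (σ ∙ 0) [ 1 ] ] r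
                      | cutPart-++ σ (suSteps n β) (act pos (σ ∙ 0) [ 1 ] ∷ r)
                      | proj₁ steps-visible | ≼ᵇ-complete (⊑-∙ 0 (⊑-refl σ)) = refl

    suPre-ext : (r : List Action) → extPart σ (pre ++ r) ≡ suSteps n β ++ extPart σ r
    suPre-ext r rewrite ≼ᵇ-complete (⊑-refl σ) | ++-assoc (suSteps n β) [ act pos (σ ∙ 0) [ 1 ] ] r
                      | extPart-++ σ (suSteps n β) (act pos (σ ∙ 0) [ 1 ] ∷ r)
                      | proj₂ steps-visible | ≼ᵇ-complete (⊑-∙ 0 (⊑-refl σ)) = refl

  run-dualCut : (m : ℕ) → dualCut σ (run m) ≡ natChron m σ
  run-dualCut zero rewrite ≼ᵇ-complete (⊑-refl σ) | proj₁ nat-visible = refl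
  run-dualCut (suc k) rewrite suPre-cut (copycat k (σ ∙ 0 ∙ 1) (suEnd n β)) =
    cong (λ r → _ ∷ _ ∷ r) (proj₁ (copycat-parts k σ⊑σ01 β⊑end))

  run-extPart : (m : ℕ) → extPart σ (run m) ≡ natChron (m + n) β
  run-extPart zero rewrite ≼ᵇ-complete (⊑-refl σ) = proj₂ nat-visible
  run-extPart (suc k) = begin
    extPart σ (run (suc k))                     ≡⟨ suPre-ext _ ⟩
    suSteps n β ++ extPart σ (copycat k _ _)
      ≡⟨ cong (suSteps n β ++_) (proj₂ (copycat-parts k σ⊑σ01 β⊑end)) ⟩
    suSteps n β ++ natChron k (suEnd n β)        ≡⟨ suSteps-natChron n β k ⟩
    natChron (suc n + k) β                       ≡⟨ cong (λ j → natChron (suc j) β) (+-comm n k) ⟩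
    natChron (suc k + n) β                       ∎
    where open ≡-Reasoning

  run-immJust : (m : ℕ) → ImmJust (run m)
  run-immJust zero    = immJust-∷ _ (natChron-startsPositive n β) (natChron-immJust n β)
  run-immJust (suc k) =
    subst (λ r → ImmJust (act neg σ [ 0 ] ∷ r)) (sym (++-assoc (suSteps n β) _ _))
      (immJust-∷ _ (suSteps-startsPositive n)
        (suSteps-immJust n β p-act (copycat-immJust k (σ ∙ 0) (suEnd n β))))

  -- it is linear, since both its parts are numerals
  run-unique : (m : ℕ) → Unique (run m)
  run-unique m = unique-parts σ (run m)
    (unique-dualSeq (cutPart σ (run m)) (subst Unique (sym (run-dualCut m)) (natChron-unique m σ)))
    (subst Unique (sym (run-extPart m)) (natChron-unique (m + n) β))

  run-legal : (m : ℕ) → Legal σ turnD (run m) turnEnv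
  run-legal zero    = l-D (≼ᵇ-complete (⊑-refl σ)) (numeral n (⊑-refl β))
    where
    numeral : (k : ℕ) {ζ : Locus} → β ⊑ ζ → Legal σ turnE (natChron k ζ) turnEnv
    numeral zero    β⊑ζ = l-E-ext (outside β⊑ζ) l-end
    numeral (suc k) β⊑ζ =
      l-E-ext (outside β⊑ζ) (l-Env (outside (⊑-∙ 0 β⊑ζ)) (numeral k (⊑-∙ 1 (⊑-∙ 0 β⊑ζ))))
  run-legal (suc k) = l-D (≼ᵇ-complete (⊑-refl σ))
    (legal-++ (legal-++ (steps n (⊑-refl β)) (l-E-cut (≼ᵇ-complete (⊑-∙ 0 (⊑-refl σ))) l-end))
              (copy k σ⊑σ01 β⊑end))
    where
    steps : (j : ℕ) {ζ : Locus} → β ⊑ ζ → Legal σ turnE (suSteps j ζ) turnE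
    steps zero    β⊑ζ = l-E-ext (outside β⊑ζ) (l-Env (outside (⊑-∙ 0 β⊑ζ)) l-end)
    steps (suc j) β⊑ζ =
      l-E-ext (outside β⊑ζ) (l-Env (outside (⊑-∙ 0 β⊑ζ)) (steps j (⊑-∙ 1 (⊑-∙ 0 β⊑ζ))))
    copy : (j : ℕ) {ξ ξ' : Locus} → σ ⊑ ξ → β ⊑ ξ' → Legal σ turnD (copycat j ξ ξ') turnEnv
    copy zero    σ⊑ξ β⊑ξ' = l-D (≼ᵇ-complete σ⊑ξ) (l-E-ext (outside β⊑ξ') l-end)
    copy (suc j) σ⊑ξ β⊑ξ' = l-D (≼ᵇ-complete σ⊑ξ) (l-E-ext (outside β⊑ξ') (l-Env (outside (⊑-∙ 0 β⊑ξ'))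
      (l-E-cut (≼ᵇ-complete (⊑-∙ 0 σ⊑ξ)) (copy j (⊑-∙ 1 (⊑-∙ 0 σ⊑ξ)) (⊑-∙ 1 (⊑-∙ 0 β⊑ξ'))))))

  E : Design
  E = SuD n σ β

  run-in-E : (m : ℕ) {p : Chronicle} → p ⊑ run m → E p
  run-in-E zero    p⊑ = inj₁ (⊑-toΣ p⊑)
  run-in-E (suc k) p⊑ with ⊑-++-split pre p⊑
  ... | inj₁ q              = inj₂ (inj₁ (⊑-toΣ q))
  ... | inj₂ (z , refl , q) = inj₂ (inj₂ (z , copycat-Id k _ _ q , refl))

  -- The two branches of 𝔖𝔲_n, above ∅ and above {0}, start differently; a
  -- sequence on one branch cannot be answered on the other.
  root-diverge : {I I' : Ram} {L L' c : Chronicle} →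
                 c ⊑ act neg σ I ∷ L → c ⊑ act neg σ I' ∷ L' → ¬ I ≡ I' → c ≡ []
  root-diverge []         _          _    = refl
  root-diverge (refl ∷ _) (refl ∷ _) I≢I' = ⊥-elim (I≢I' refl)

  ZeroBranch : Chronicle → Set
  ZeroBranch x = IsPrefix x pre ⊎ Σ Chronicle (λ f → IdC (σ ∙ 0 ∙ 1) (suEnd n β) f × x ≡ pre ++ f)

  zeroBranch-root : {x : Chronicle} → ZeroBranch x → Σ Chronicle λ L → x ⊑ act neg σ [ 0 ] ∷ L
  zeroBranch-root (inj₁ x⊑)          = _ , ⊑-fromΣ x⊑
  zeroBranch-root (inj₂ (f , _ , e)) = _ , ⊑-reflexive e

  wrong-branch-answer : {I I' : Ram} {L L' : Chronicle} (c : Chronicle) {a : Action} →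
                        c ∷ʳ a ⊑ act neg σ I ∷ L → c ⊑ act neg σ I' ∷ L' → ¬ I ≡ I' → ¬ Positive a
  wrong-branch-answer c ca⊑ c⊑ I≢I' pa with root-diverge (⊑-trans (⊑-++ c _) ca⊑) c⊑ I≢I'
  wrong-branch-answer _ (refl ∷ _) _ _ () | refl

  wrong-branch-deviation : {I I' : Ram} {L L' : Chronicle} (p : Chronicle) {κ a : Action} →
                           (p ∷ʳ κ) ∷ʳ a ⊑ act neg σ I ∷ L → p ⊑ act neg σ I' ∷ L' → ¬ I ≡ I' →
                           ¬ cutᵇ σ κ ≡ false
  wrong-branch-deviation p pκa⊑ p⊑ I≢I' ext
    with root-diverge (⊑-trans (⊑-++ p _) (⊑-trans (⊑-++ (p ∷ʳ _) _) pκa⊑)) p⊑ I≢I'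
  wrong-branch-deviation _ (refl ∷ _) _ _ ext | refl =
    true≢false (trans (sym (≼ᵇ-complete (⊑-refl σ))) ext)

  E-answer : (m : ℕ) (c : Chronicle) {a : Action} → E (c ∷ʳ a) → c ⊑ run m → Positive a →
             c ∷ʳ a ⊑ run m
  E-answer zero    c (inj₁ x)  _  _  = ⊑-fromΣ x
  E-answer zero    c (inj₂ x)  c⊑ pa = ⊥-elim (wrong-branch-answer c (proj₂ (zeroBranch-root x)) c⊑ (λ ()) pa)
  E-answer (suc k) c (inj₁ x)  c⊑ pa = ⊥-elim (wrong-branch-answer c (⊑-fromΣ x) c⊑ (λ ()) pa)
  E-answer (suc k) c (inj₂ (inj₁ x)) _ _ = ⊑-trans (⊑-fromΣ x) (⊑-++ _ _)
  E-answer (suc k) c (inj₂ (inj₂ (f , idc , e))) c⊑ pa with reverseView f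
  ... | [] = ⊑-trans (⊑-reflexive (trans e (++-identityʳ _))) (⊑-++ _ _)
  ... | f′ ∶ _ ∶ʳ a′
    with refl , refl ← ∷ʳ-injective c (pre ++ f′) (trans e (sym (++-assoc pre f′ [ a′ ])))
    = subst (_⊑ run (suc k)) (sym (++-assoc pre f′ [ a′ ]))
        (⊑-prepend pre (copycat-answer k _ _ f′ idc (⊑-unprepend pre c⊑) pa))

  E-deviation : (m : ℕ) (p : Chronicle) {ζ : Locus} {J : Ram} {a : Action} →
                E ((p ∷ʳ act neg ζ J) ∷ʳ a) → p ⊑ run m → cutᵇ σ (act neg ζ J) ≡ false →
                p ∷ʳ act neg ζ J ⊑ run m ⊎ DeviantCut σ a
  E-deviation zero    p (inj₁ x) _ _ = inj₁ (⊑-trans (⊑-++ (p ∷ʳ _) _) (⊑-fromΣ x))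
  E-deviation zero    p (inj₂ x) p⊑ ext =
    ⊥-elim (wrong-branch-deviation p (proj₂ (zeroBranch-root x)) p⊑ (λ ()) ext)
  E-deviation (suc k) p (inj₁ x) p⊑ ext = ⊥-elim (wrong-branch-deviation p (⊑-fromΣ x) p⊑ (λ ()) ext)
  E-deviation (suc k) p (inj₂ (inj₁ x)) _ _ =
    inj₁ (⊑-trans (⊑-++ (p ∷ʳ _) _) (⊑-trans (⊑-fromΣ x) (⊑-++ _ _)))
  E-deviation (suc k) p (inj₂ (inj₂ (f , idc , e))) p⊑ ext with reverseView f
  ... | [] =
    inj₁ (⊑-trans (⊑-++ (p ∷ʳ _) _) (⊑-trans (⊑-reflexive (trans e (++-identityʳ _))) (⊑-++ _ _)))
  ... | f₁ ∶ r₁ ∶ʳ a₁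
    with e₁ , refl ← ∷ʳ-injective (p ∷ʳ _) (pre ++ f₁) (trans e (sym (++-assoc pre f₁ [ a₁ ])))
    with r₁
  ...   | [] = inj₁ (⊑-trans (⊑-reflexive (trans e₁ (++-identityʳ _))) (⊑-++ _ _))
  ...   | f₂ ∶ _ ∶ʳ κ
    with refl , refl ← ∷ʳ-injective p (pre ++ f₂) (trans e₁ (sym (++-assoc pre f₂ [ κ ])))
    with copycat-deviation σ k _ _ f₂ idc σ⊑σ01 (⊑-unprepend pre p⊑) ext
  ...     | inj₂ d = inj₂ d
  ...     | inj₁ q = inj₁ (subst (_⊑ run (suc k)) (sym (++-assoc pre f₂ [ κ ])) (⊑-prepend pre q))

  suPre-proper : All Proper pre
  suPre-proper = tt ∷ ++⁺ (All.map (λ {a} → located-proper a) (suSteps-located n β)) (tt ∷ [])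

  E-no-daimon : (v : Chronicle) → ¬ E (v ∷ʳ daimon)
  E-no-daimon v (inj₁ x) =
    proper-∷ʳ-daimon v (⊑-fromΣ x) (tt ∷ All.map (λ {a} → located-proper a) (natChron-located n β))
  E-no-daimon v (inj₂ (inj₁ x)) = proper-∷ʳ-daimon v (⊑-fromΣ x) suPre-proper
  E-no-daimon v (inj₂ (inj₂ (f , idc , e))) =
    proper-∷ʳ-daimon v (⊑-reflexive e) (++⁺ suPre-proper (fax-proper idc))

  module WithNumeral (m : ℕ) where

    D : Design
    D = natD m σ

    D-no-daimon : (v : Chronicle) → ¬ D (v ∷ʳ daimon)
    D-no-daimon v x =
      proper-∷ʳ-daimon v (⊑-fromΣ x) (All.map (λ {a} → located-proper a) (natChron-located m σ))

    on-run-immJust : {s : Chronicle} → s ⊑ run m → ImmJust s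
    on-run-immJust s⊑ = immJust-⊑ s⊑ (run-immJust m)

    on-run-dualCut : {s : Chronicle} → s ⊑ run m → dualCut σ s ⊑ natChron m σ
    on-run-dualCut {s} s⊑ with r , e ← ⊑-toΣ s⊑ =
      subst (dualCut σ s ⊑_)
        (trans (sym (dualCut-++ σ s r)) (trans (cong (dualCut σ) (sym e)) (run-dualCut m)))
        (⊑-++ (dualCut σ s) (dualCut σ r))

    on-run-extPart : {s : Chronicle} → s ⊑ run m → extPart σ s ⊑ natChron (m + n) β
    on-run-extPart {s} s⊑ with r , e ← ⊑-toΣ s⊑ =
      subst (extPart σ s ⊑_)
        (trans (sym (extPart-++ σ s r)) (trans (cong (extPart σ) (sym e)) (run-extPart m)))
        (⊑-++ (extPart σ s) (extPart σ r))

    on-run-next : (s : Chronicle) {x : Action} {r : Chronicle} → run m ≡ s ++ x ∷ r → s ∷ʳ x ⊑ run m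
    on-run-next s {x} {r} e =
      subst (s ∷ʳ x ⊑_) (trans (++-assoc s [ x ] r) (sym e)) (⊑-++ (s ∷ʳ x) r)

    path-init : (s : Chronicle) {a : Action} {t : Turn} → Path σ D E (s ∷ʳ a) t →
                Σ Turn λ t₁ → Path σ D E s t₁ × Legal σ t₁ [ a ] t
    path-init s {a} P with t₁ , l₁ , l₂ ← legal-split s (Path.legal P) = t₁ , record
      { legal  = l₁
      ; linear = unique-init s (Path.linear P)
      ; viewE  = λ p q e → Path.viewE P p (q ∷ʳ a) (trans (cong (_∷ʳ a) e) (++-assoc p q [ a ]))
      ; viewD  = λ p q e → Path.viewD P p (q ∷ʳ a) (trans (cong (_∷ʳ a) e) (++-assoc p q [ a ]))
      } , l₂

    E-sees : {s : Chronicle} {t : Turn} → Path σ D E s t → Σ Chronicle λ v → View s v × E v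
    E-sees {s} P = Path.viewE P s [] (sym (++-identityʳ s))

    D-sees : {s : Chronicle} {t : Turn} → Path σ D E s t →
             Σ Chronicle λ v → View (dualCut σ s) v × D v
    D-sees {s} P = Path.viewD P s [] (sym (++-identityʳ s))

    E-move : {s : Chronicle} {a : Action} {t : Turn} → s ⊑ run m → Path σ D E (s ∷ʳ a) t → Positive a →
             s ∷ʳ a ⊑ run m
    E-move {s} s⊑ P pa
      with v , vw , ev ← E-sees P
      with v′ , vw′ , refl ← view-pos vw refl pa
      with refl ← view-immJust (on-run-immJust s⊑) vw′
      = E-answer m s ev s⊑ pa

    D-move : {s : Chronicle} {ξ : Locus} {I : Ram} {t : Turn} → s ⊑ run m → Path σ D E s turnD →
             Path σ D E (s ∷ʳ act neg ξ I) t → cutᵇ σ (act neg ξ I) ≡ true → s ∷ʳ act neg ξ I ⊑ run m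
    D-move {s} s⊑ P₁ P cut
      with r , e ← ⊑-toΣ s⊑
      with t₁ , ls , lr ← legal-split s (subst (λ L → Legal σ turnD L turnEnv) e (run-legal m))
      with refl ← legal-turn-unique ls (Path.legal P₁)
      with r | lr
    ... | x ∷ r′ | l-D cut′ _
      with v , vw , dv ← D-sees P
      with v′ , vw′ , refl ← view-pos vw (dualCut-∷ʳ σ s cut) p-act
      with refl ← view-immJust (immJust-⊑ (on-run-dualCut s⊑) (natChron-immJust m σ)) vw′
      with refl ← ⊑-next-unique (dualCut σ s) (⊑-fromΣ dv)
                    (subst (_⊑ natChron m σ) (dualCut-∷ʳ σ s cut′) (on-run-dualCut (on-run-next s e)))
      = on-run-next s e

    -- Every interaction path is a prefix of the canonical interaction, except
    -- possibly for a last external negative action not yet answered by E.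
    data Tracked (s : Chronicle) : Set where
      on-run  : s ⊑ run m → Tracked s
      pending : (s₀ : Chronicle) {ζ : Locus} {J : Ram} → s ≡ s₀ ∷ʳ act neg ζ J → s₀ ⊑ run m →
                cutᵇ σ (act neg ζ J) ≡ false → Tracked s

    pending-turn : {t : Turn} (s₀ : Chronicle) {ζ : Locus} {J : Ram} →
                   Legal σ turnD (s₀ ∷ʳ act neg ζ J) t → cutᵇ σ (act neg ζ J) ≡ false → t ≡ turnE
    pending-turn s₀ l ext with legal-split s₀ l
    ... | _ , _ , l-D cut _     = ⊥-elim (true≢false (trans (sym cut) ext))
    ... | _ , _ , l-Env _ l-end = refl

    -- D refuses a deviant action of E ≼ᵇ-complete the cut: the numeral only
    -- accepts the ramification {1}
    D-refuses : (s : Chronicle) {a : Action} {t : Turn} → Path σ D E (s ∷ʳ a) t → ¬ DeviantCut σ a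
    D-refuses s P (ζ , J , refl , σ⊑ζ , J≢1)
      with v , vw , dv ← D-sees P
      with q , refl ← view-last vw (dualCut-∷ʳ σ s (≼ᵇ-complete σ⊑ζ))
      = J≢1 (all-last q (all-⊑ (⊑-fromΣ dv) (natChron-ramOne m σ)))

    -- When E answers a pending action κ, κ was on the canonical interaction:
    -- otherwise E either repeats κ (against linearity) or deviates ≼ᵇ-complete the
    -- cut, which D refuses.
    resolve : (s₀ : Chronicle) {ζ : Locus} {J : Ram} {a : Action} {t : Turn} → s₀ ⊑ run m →
              cutᵇ σ (act neg ζ J) ≡ false → Path σ D E ((s₀ ∷ʳ act neg ζ J) ∷ʳ a) t → Positive a →
              s₀ ∷ʳ act neg ζ J ⊑ run m
    resolve s₀ s₀⊑ ext P pa
      with v , vw , ev ← E-sees P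
      with v′ , vw′ , refl ← view-pos vw refl pa
      with p , p⊑s₀ , refl ← view-immJust-neg (on-run-immJust s₀⊑) n-act vw′ refl
      with E-deviation m p ev (⊑-trans p⊑s₀ s₀⊑) ext
    ... | inj₁ pκ⊑ = ⊑-linear-extend p⊑s₀ s₀⊑ pκ⊑ (unique-init (s₀ ∷ʳ _) (Path.linear P))
    ... | inj₂ d   = ⊥-elim (D-refuses (s₀ ∷ʳ _) P d)

    pending-answer : (s₀ : Chronicle) {ζ : Locus} {J : Ram} {a : Action} {t : Turn} → s₀ ⊑ run m →
                     cutᵇ σ (act neg ζ J) ≡ false → Path σ D E ((s₀ ∷ʳ act neg ζ J) ∷ʳ a) t →
                     (s₀ ∷ʳ act neg ζ J) ∷ʳ a ⊑ run m
    pending-answer s₀ s₀⊑ ext P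
      with _ , P₁ , l ← path-init (s₀ ∷ʳ _) P
      with refl ← pending-turn s₀ (Path.legal P₁) ext
      with l
    ... | l-E-cut _ l-end = E-move (resolve s₀ s₀⊑ ext P p-act) P p-act
    ... | l-E-ext _ l-end = E-move (resolve s₀ s₀⊑ ext P p-act) P p-act

    track-step : (s : Chronicle) (a : Action) {t : Turn} → Tracked s → Path σ D E (s ∷ʳ a) t →
                 Tracked (s ∷ʳ a)
    track-step s a (on-run s⊑) P with path-init s P
    ... | _ , P₁ , l-D cut l-end   = on-run (D-move s⊑ P₁ P cut)
    ... | _ , _  , l-E-cut _ l-end = on-run (E-move s⊑ P p-act)
    ... | _ , _  , l-E-ext _ l-end = on-run (E-move s⊑ P p-act)
    ... | _ , _  , l-Env ext l-end = pending s refl s⊑ ext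
    track-step s a (pending s₀ refl s₀⊑ ext) P = on-run (pending-answer s₀ s₀⊑ ext P)

    track : {s : Chronicle} {t : Turn} → Path σ D E s t → Tracked s
    track {s} = go (reverseView s)
      where
      go : {s : Chronicle} {t : Turn} → Reverse s → Path σ D E s t → Tracked s
      go []             _ = on-run []
      go (s ∶ r ∶ʳ a) P with _ , P₁ , _ ← path-init s P = track-step s a (go r P₁) P

    completed-sound : {c : Chronicle} → Completed σ D E c → c ⊑ natChron (m + n) β
    completed-sound (c-vis P vw) with track P
    ... | on-run s⊑ with refl ← view-immJust (immJust-⊑ (on-run-extPart s⊑) (natChron-immJust (m + n) β)) vw =
      on-run-extPart s⊑
    ... | pending s₀ refl _ ext with () ← pending-turn s₀ (Path.legal P) ext
    completed-sound (c-daiE {v = v} _ _ _ ev) = ⊥-elim (E-no-daimon v ev)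
    completed-sound (c-daiD {v = v} _ _ _ dv) = ⊥-elim (D-no-daimon v dv)

    run-path : Path σ D E (run m) turnEnv
    run-path = record
      { legal  = run-legal m
      ; linear = run-unique m
      ; viewE  = λ p q e → let p⊑ = ⊑-fromΣ (q , e) in
                   p , immJust-view p (on-run-immJust p⊑) , run-in-E m p⊑
      ; viewD  = λ p q e → let p⊑ = on-run-dualCut (⊑-fromΣ (q , e)) in
                   dualCut σ p , immJust-view _ (immJust-⊑ p⊑ (natChron-immJust m σ)) , ⊑-toΣ p⊑
      }

    run-completed : Completed σ D E (natChron (m + n) β)
    run-completed = c-vis run-path (subst (λ L → View L (natChron (m + n) β)) (sym (run-extPart m))
                                       (immJust-view _ (natChron-immJust (m + n) β)))

    normalForm : NormalForm σ D E ≐ natD (m + n) β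
    normalForm c = (λ (c′ , comp , c⊑c′) → ⊑-toΣ (⊑-trans (⊑-fromΣ c⊑c′) (completed-sound comp)))
                 , (λ c⊑ → natChron (m + n) β , run-completed , c⊑)

natD-inNat : (k : ℕ) (β : Locus) → InNat β (natD k β)
natD-inNat k β = k , λ _ → (λ x → x) , (λ x → x)

mainTheorem3 : (σ β : Locus) → DisjointLoci σ β → (m n : ℕ) →
    NonCanonicalTerm (cutNet σ (natD m σ) (SuD n σ β) β)
    × (nf (cutNet σ (natD m σ) (SuD n σ β) β) ≐ natD (m + n) β)
    × CanonicalTerm (single β (natD (m + n) β))
-- The cut-net has a cut and its normal form is the numeral 𝐦+𝐧, so it is a
-- non-canonical term of ℕat; 𝐦+𝐧 itself is cut-free, hence canonical.
mainTheorem3 σ β disjoint m n =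
  ((m + n , normalForm) , tt) , normalForm , (natD-inNat (m + n) β , λ ())
  where open Interaction.WithNumeral σ β disjoint n m using (normalForm)
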